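{- Let $c$, $k$ and $t$ be positive integers with $c\ge 6$ and $k\ge t+3$. (i) If $c\ge 4\log_2 t+7$ or $k\ge 2t+3$, then $g(c,k,t,t+1)\,g(c,k,t,t+2)<(f_0(c,k,t))^2$. (ii) If $c\ge 4\log_2 t+7$, then $g(c,t+3,t,t+1)\,g(c,t+3,t,t+3)<(f_0(c,t+3,t))^2$.
   Context: For integers $t\le z\le k$, $\theta(c,k,z)=\frac{1}{(k-z)!}\prod_{i=z}^{k-1}\binom{(k-i)c}{c}$, $g(c,k,t,z)=\theta(c,k,z)\binom{z}{t}\prod_{j=1}^{z-t}\bigl(k-(t+j-1)\bigr)$, and $f_0(c,k,t)=(k-t-1)\theta(c,k,t+1)-\binom{k-t-1}{2}\theta(c,k,t+2)$. -}

module Defs where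

open import Data.Nat as ℕ using (ℕ; _∸_; _!; suc)
open import Data.Nat.Properties using (_!≢0)
open import Data.Nat.Combinatorics using (_C_)
open import Data.List using (map; upTo)
open import Data.Nat.ListAction using (product)
open import Data.Integer using (+_)
open import Data.Rational using (ℚ; _/_; _*_; _-_)

-- ∏_{i=a}^{b-1} f i  (empty product = 1 when b ≤ a)
∏[_≤i<_] : ℕ → ℕ → (ℕ → ℕ) → ℕ
∏[ a ≤i< b ] f = product (map (λ j → f (a ℕ.+ j)) (upTo (b ∸ a)))

∏[1≤j≤_] : ℕ → (ℕ → ℕ) → ℕ
∏[1≤j≤ n ] f = product (map (λ j → f (suc j)) (upTo n))

θ : ℕ → ℕ → ℕ → ℚ
θ c k z = (+ ∏[ z ≤i< k ] (λ i → ((k ∸ i) ℕ.* c) C c)) / ((k ∸ z) !)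
  where instance _ = (k ∸ z) !≢0

g : ℕ → ℕ → ℕ → ℕ → ℚ
g c k t z = θ c k z * ((+ ((z C t) ℕ.* ∏[1≤j≤ z ∸ t ] (λ j → k ∸ (t ℕ.+ j ∸ 1)))) / 1)

f₀ : ℕ → ℕ → ℕ → ℚ
f₀ c k t = ((+ (k ∸ t ∸ 1)) / 1) * θ c k (t ℕ.+ 1)
         - ((+ ((k ∸ t ∸ 1) C 2)) / 1) * θ c k (t ℕ.+ 2)

-- Write m = k − t − 1 and R = C(mc, c). Splitting off the factor i = t + 1 of the product defining
-- θ(c,k,t+1) gives m θ(c,k,t+1) = R θ(c,k,t+2). Since g(c,k,t,z) = θ(c,k,z) A_z with an integer A_z and
-- f₀ = m θ(c,k,t+1) − C(m,2) θ(c,k,t+2), the two sides of (i) are θ(c,k,t+2)² / m times the two sides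
-- of the integer inequality R A_{t+1} A_{t+2} < m (R − C(m,2))². For (ii), k = t + 3 gives m = 2 and
-- θ(c,k,t+3) = θ(c,k,t+2), so the same reduction applies with A_{t+3} in place of A_{t+2}.
-- The integer inequality holds because R is exponentially large, R ≥ 7 m^(c−1), while A_{t+1} A_{t+2} / m
-- and C(m,2) are polynomials in t and m: either hypothesis (2⁷t⁴ ≤ 2^c, or m ≥ t + 2) puts the
-- polynomial below R/2, and then (R − C(m,2))² ≥ R²/4 wins.

module Submission where

open import Data.Nat using (ℕ; zero; suc; _≤_; _<_; _+_; _*_; _^_; _∸_; _!; s≤s; z≤n; NonZero; >-nonZero)
open import Data.Nat.Properties
open import Data.Nat.Combinatorics using (_C_; nC1≡n; nCn≡1; nCk≡nC[n∸k]; nCk+nC[k+1]≡[n+1]C[k+1])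
open import Data.Nat.ListAction using (product)
open import Data.Nat.ListAction.Properties using (product≢0)
open import Data.Nat.Tactic.RingSolver using (solve-∀)
open import Algebra.Properties.CommutativeSemigroup *-commutativeSemigroup using (x∙yz≈y∙xz)
open import Data.List using (map; upTo; applyUpTo)
open import Data.List.Properties using (map-upTo; map-applyUpTo; map-cong)
open import Data.List.Relation.Unary.All using (All)
open import Data.List.Relation.Unary.All.Properties using (applyUpTo⁺₁)
open import Data.Integer as ℤ using (+_)
import Data.Integer.Properties as ℤ
open import Data.Rational as ℚ using (ℚ; _/_; toℚᵘ; Positive)
import Data.Rational.Properties as ℚ
open import Data.Rational.Solver using (module +-*-Solver)
import Data.Rational.Unnormalised as ℚᵘ
import Data.Rational.Unnormalised.Properties as ℚᵘ
open import Data.Product using (_×_; _,_)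
open import Data.Sum using (_⊎_; inj₁; inj₂; map₂)
open import Relation.Binary.PropositionalEquality
open import Defs

-- Binomial coefficients

C-absorption : ∀ n k → suc k * (suc n C suc k) ≡ suc n * (n C k)
C-absorption n zero = trans (+-identityʳ _) (trans (nC1≡n (suc n)) (sym (*-identityʳ (suc n))))
C-absorption zero (suc k) = *-zeroʳ (suc (suc k))
C-absorption (suc n) (suc k) = begin
  suc (suc k) * (suc (suc n) C suc (suc k))
    ≡⟨ cong (suc (suc k) *_) (nCk+nC[k+1]≡[n+1]C[k+1] (suc n) (suc k)) ⟨
  suc (suc k) * (suc n C suc k + suc n C suc (suc k))
    ≡⟨ *-distribˡ-+ (suc (suc k)) (suc n C suc k) _ ⟩
  (suc n C suc k + suc k * (suc n C suc k)) + suc (suc k) * (suc n C suc (suc k))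
    ≡⟨ cong₂ (λ a b → (suc n C suc k + a) + b) (C-absorption n k) (C-absorption n (suc k)) ⟩
  (suc n C suc k + suc n * (n C k)) + suc n * (n C suc k)
    ≡⟨ +-assoc (suc n C suc k) _ _ ⟩
  suc n C suc k + (suc n * (n C k) + suc n * (n C suc k))
    ≡⟨ cong (λ x → suc n C suc k + x) (*-distribˡ-+ (suc n) (n C k) _) ⟨
  suc n C suc k + suc n * (n C k + n C suc k)
    ≡⟨ cong (λ x → suc n C suc k + suc n * x) (nCk+nC[k+1]≡[n+1]C[k+1] n k) ⟩
  suc (suc n) * (suc n C suc k) ∎
  where open ≡-Reasoning

nCk-pos : ∀ {n k} → k ≤ n → 0 < n C k
nCk-pos {n} {zero} _ = s≤s z≤n
nCk-pos {suc n} {suc k} (s≤s k≤n) = <-≤-trans (nCk-pos k≤n)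
  (subst (n C k ≤_) (nCk+nC[k+1]≡[n+1]C[k+1] n k) (m≤m+n (n C k) (n C suc k)))

[n+k]Cn≡[n+k]Ck : ∀ n k → (n + k) C n ≡ (n + k) C k
[n+k]Cn≡[n+k]Ck n k = trans (nCk≡nC[n∸k] (m≤m+n n k)) (cong ((n + k) C_) (m+n∸m≡n n k))

[n+1]Cn≡n+1 : ∀ n → (n + 1) C n ≡ n + 1
[n+1]Cn≡n+1 n = trans ([n+k]Cn≡[n+k]Ck n 1) (nC1≡n (n + 1))

2*[2+n]C2≡[2+n][1+n] : ∀ n → 2 * ((2 + n) C 2) ≡ (2 + n) * (1 + n)
2*[2+n]C2≡[2+n][1+n] n = trans (C-absorption (suc n) 1) (cong ((2 + n) *_) (nC1≡n (1 + n)))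

2*[n+2]Cn≡[n+2][n+1] : ∀ n → 2 * ((n + 2) C n) ≡ (n + 2) * (n + 1)
2*[n+2]Cn≡[n+2][n+1] n rewrite [n+k]Cn≡[n+k]Ck n 2 | +-comm n 2 | +-comm n 1 = 2*[2+n]C2≡[2+n][1+n] n

6*[n+3]Cn≡[n+3][n+2][n+1] : ∀ n → 6 * ((n + 3) C n) ≡ (n + 3) * ((n + 2) * (n + 1))
6*[n+3]Cn≡[n+3][n+2][n+1] n rewrite [n+k]Cn≡[n+k]Ck n 3 | +-comm n 3 | +-comm n 2 | +-comm n 1 = begin
  6 * ((3 + n) C 3)             ≡⟨ *-assoc 2 3 ((3 + n) C 3) ⟩
  2 * (3 * ((3 + n) C 3))       ≡⟨ cong (2 *_) (C-absorption (2 + n) 2) ⟩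
  2 * ((3 + n) * ((2 + n) C 2)) ≡⟨ x∙yz≈y∙xz 2 (3 + n) ((2 + n) C 2) ⟩
  (3 + n) * (2 * ((2 + n) C 2)) ≡⟨ cong ((3 + n) *_) (2*[2+n]C2≡[2+n][1+n] n) ⟩
  (3 + n) * ((2 + n) * (1 + n)) ∎
  where open ≡-Reasoning

-- Each absorption step multiplies by (N + j + 2)/(j + 2), which is at least m + 1 while j + 2 ≤ c.
C-growth : ∀ m c j → j < c → suc (m * c) * suc m ^ j ≤ suc (m * c + j) C suc j
C-growth m c zero _ = begin
  suc (m * c) * 1     ≡⟨ *-identityʳ _ ⟩
  suc (m * c)         ≡⟨ cong suc (+-identityʳ (m * c)) ⟨
  suc (m * c + 0)     ≡⟨ nC1≡n _ ⟨
  suc (m * c + 0) C 1 ∎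
  where open ≤-Reasoning
C-growth m c (suc j) j+1<c = *-cancelˡ-≤ (suc (suc j)) (begin
  suc (suc j) * (suc N * suc m ^ suc j)         ≡⟨ rearrange (suc (suc j)) (suc N) (suc m) (suc m ^ j) ⟩
  (suc m * suc (suc j)) * (suc N * suc m ^ j)   ≤⟨ *-mono-≤ factor≤ (C-growth m c j (<-trans (n<1+n j) j+1<c)) ⟩
  suc (N + suc j) * (suc (N + j) C suc j)       ≡⟨ cong (λ n → suc (N + suc j) * (n C suc j)) (+-suc N j) ⟨
  suc (N + suc j) * ((N + suc j) C suc j)       ≡⟨ C-absorption (N + suc j) (suc j) ⟨
  suc (suc j) * (suc (N + suc j) C suc (suc j)) ∎)
  where
  open ≤-Reasoning
  N = m * c
  rearrange : ∀ a b x y → a * (b * (x * y)) ≡ (x * a) * (b * y)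
  rearrange = solve-∀
  factor≤ : suc m * suc (suc j) ≤ suc (N + suc j)
  factor≤ = begin
    suc (suc j) + m * suc (suc j) ≤⟨ +-monoʳ-≤ (suc (suc j)) (*-monoʳ-≤ m j+1<c) ⟩
    suc (suc j) + N               ≡⟨ cong suc (+-comm (suc j) N) ⟩
    suc (N + suc j)               ∎

[m+1][c+1]C[c+1]-lower-bound : ∀ m c → suc (m * suc c) * suc m ^ c ≤ (suc m * suc c) C suc c
[m+1][c+1]C[c+1]-lower-bound m c =
  subst (λ n → suc (m * suc c) * suc m ^ c ≤ n C suc c) (cong suc (+-comm (m * suc c) c)) (C-growth m (suc c) c ≤-refl)

7*[2+q]^[5+d]≤[2+q][6+d]C[6+d] : ∀ q d → 7 * (2 + q) ^ (5 + d) ≤ ((2 + q) * (6 + d)) C (6 + d)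
7*[2+q]^[5+d]≤[2+q][6+d]C[6+d] q d =
  ≤-trans (*-monoˡ-≤ ((2 + q) ^ (5 + d)) 7≤N+1) ([m+1][c+1]C[c+1]-lower-bound (suc q) (5 + d))
  where
  7≤N+1 : 7 ≤ suc ((1 + q) * (6 + d))
  7≤N+1 = s≤s (≤-trans (m≤m+n 6 d) (m≤m+n (6 + d) (q * (6 + d))))

-- Polynomial estimates

-- The substitution t = 1 + s is made by subst rather than by matching on refl, which would make the
-- type checker compare the two polynomials by normalising them.
[t+1]²[t+2]≤12t⁴ : ∀ {t} → 1 ≤ t → (t + 1) * (t + 1) * (t + 2) ≤ 12 * t ^ 4
[t+1]²[t+2]≤12t⁴ 1≤t with m≤n⇒∃[o]m+o≡n 1≤t
... | s , 1+s≡t =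
  subst (λ t → (t + 1) * (t + 1) * (t + 2) ≤ 12 * t ^ 4) 1+s≡t (m+n≤o⇒m≤o _ (≤-reflexive (expand s)))
  where
  expand : ∀ s → (1 + s + 1) * (1 + s + 1) * (1 + s + 2) + (12 * s * s * s * s + 47 * s * s * s + 65 * s * s + 32 * s)
           ≡ 12 * ((1 + s) * ((1 + s) * ((1 + s) * ((1 + s) * 1))))
  expand = solve-∀

[t+1]²[t+2][t+3]≤48t⁴ : ∀ {t} → 1 ≤ t → (t + 1) * (t + 1) * (t + 2) * (t + 3) ≤ 48 * t ^ 4
[t+1]²[t+2][t+3]≤48t⁴ 1≤t with m≤n⇒∃[o]m+o≡n 1≤t
... | s , 1+s≡t =
  subst (λ t → (t + 1) * (t + 1) * (t + 2) * (t + 3) ≤ 48 * t ^ 4) 1+s≡t (m+n≤o⇒m≤o _ (≤-reflexive (expand s)))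
  where
  expand : ∀ s → (1 + s + 1) * (1 + s + 1) * (1 + s + 2) * (1 + s + 3) + (47 * s * s * s * s + 181 * s * s * s + 244 * s * s + 116 * s)
           ≡ 48 * ((1 + s) * ((1 + s) * ((1 + s) * ((1 + s) * 1))))
  expand = solve-∀

[3+q]²≤4[2+q]² : ∀ q → (3 + q) * (3 + q) ≤ 4 * ((2 + q) * (2 + q))
[3+q]²≤4[2+q]² q = m+n≤o⇒m≤o _ (≤-reflexive (expand q))
  where
  expand : ∀ q → (3 + q) * (3 + q) + (3 * q * q + 10 * q + 7) ≡ 4 * ((2 + q) * (2 + q))
  expand = solve-∀

4[3+q]²≤9[2+q]² : ∀ q → 4 * ((3 + q) * (3 + q)) ≤ 9 * ((2 + q) * (2 + q))
4[3+q]²≤9[2+q]² q = m+n≤o⇒m≤o _ (≤-reflexive (expand q))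
  where
  expand : ∀ q → 4 * ((3 + q) * (3 + q)) + (5 * q * q + 12 * q) ≡ 9 * ((2 + q) * (2 + q))
  expand = solve-∀

2*[2+q]C2≤R : ∀ {q d R} → 7 * (2 + q) ^ (5 + d) ≤ R → 2 * ((2 + q) C 2) ≤ R
2*[2+q]C2≤R {q} {d} {R} hR = begin
  2 * ((2 + q) C 2)       ≡⟨ 2*[2+n]C2≡[2+n][1+n] q ⟩
  (2 + q) * (1 + q)       ≤⟨ *-monoʳ-≤ (2 + q) (n≤1+n (1 + q)) ⟩
  (2 + q) * (2 + q)       ≡⟨ cong ((2 + q) *_) (*-identityʳ (2 + q)) ⟨
  (2 + q) ^ 2             ≤⟨ ^-monoʳ-≤ (2 + q) {2} {5 + d} (s≤s (s≤s z≤n)) ⟩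
  (2 + q) ^ (5 + d)       ≤⟨ m≤m+n ((2 + q) ^ (5 + d)) (6 * (2 + q) ^ (5 + d)) ⟩
  7 * (2 + q) ^ (5 + d)   ≤⟨ hR ⟩
  R                       ∎
  where open ≤-Reasoning

2*[t+1]²[t+2][3+q]²<R : ∀ {t q d R} → 1 ≤ t → 7 * (2 + q) ^ (5 + d) ≤ R →
                        (2 ^ 7 * t ^ 4 ≤ 2 ^ (6 + d) ⊎ t + 2 ≤ 2 + q) →
                        2 * ((t + 1) * (t + 1) * (t + 2) * ((3 + q) * (3 + q))) < R
2*[t+1]²[t+2][3+q]²<R {t} {q} {d} {R} 1≤t hR (inj₁ 2⁷t⁴≤2ᶜ) = *-cancelˡ-< 128 _ _ (begin-strict
  128 * (2 * ((t + 1) * (t + 1) * (t + 2) * ((3 + q) * (3 + q))))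
    ≡⟨ 128[2xy]≡2x*128*y ((t + 1) * (t + 1) * (t + 2)) ((3 + q) * (3 + q)) ⟩
  2 * ((t + 1) * (t + 1) * (t + 2)) * 128 * ((3 + q) * (3 + q))
    ≤⟨ *-mono-≤ (*-monoˡ-≤ 128 (*-monoʳ-≤ 2 ([t+1]²[t+2]≤12t⁴ 1≤t))) ([3+q]²≤4[2+q]² q) ⟩
  2 * (12 * t ^ 4) * 128 * (4 * (M * M))  ≡⟨ 2[12x]*128*[4y]≡96[128x]y (t ^ 4) (M * M) ⟩
  96 * (2 ^ 7 * t ^ 4) * (M * M)          ≤⟨ *-monoˡ-≤ (M * M) (*-monoʳ-≤ 96 2⁷t⁴≤2ᶜ) ⟩
  96 * 2 ^ (6 + d) * (M * M)              ≡⟨ 96[8p]y≡768[py] (2 ^ (3 + d)) (M * M) ⟩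
  768 * (2 ^ (3 + d) * (M * M))
    <⟨ *-monoˡ-< (2 ^ (3 + d) * (M * M)) {{m*n≢0 (2 ^ (3 + d)) (M * M) {{m^n≢0 2 (3 + d)}}}} (s≤s (m≤m+n 768 127)) ⟩
  896 * (2 ^ (3 + d) * (M * M))           ≤⟨ *-monoʳ-≤ 896 (*-monoˡ-≤ (M * M) (^-monoˡ-≤ (3 + d) (s≤s (s≤s z≤n)))) ⟩
  896 * (M ^ (3 + d) * (M * M))           ≡⟨ 896[p*m²]≡128[7*m²p] (M ^ (3 + d)) M ⟩
  128 * (7 * M ^ (5 + d))                 ≤⟨ *-monoʳ-≤ 128 hR ⟩
  128 * R                                 ∎)
  where
  open ≤-Reasoning
  M = 2 + q
  128[2xy]≡2x*128*y : ∀ x y → 128 * (2 * (x * y)) ≡ 2 * x * 128 * y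
  128[2xy]≡2x*128*y = solve-∀
  2[12x]*128*[4y]≡96[128x]y : ∀ x y → 2 * (12 * x) * 128 * (4 * y) ≡ 96 * (128 * x) * y
  2[12x]*128*[4y]≡96[128x]y = solve-∀
  96[8p]y≡768[py] : ∀ p y → 96 * (2 * (2 * (2 * p))) * y ≡ 768 * (p * y)
  96[8p]y≡768[py] = solve-∀
  896[p*m²]≡128[7*m²p] : ∀ p m → 896 * (p * (m * m)) ≡ 128 * (7 * (m * (m * p)))
  896[p*m²]≡128[7*m²p] = solve-∀
2*[t+1]²[t+2][3+q]²<R {t} {q} {d} {R} 1≤t hR (inj₂ t+2≤M) = *-cancelˡ-< 4 _ _ (begin-strict
  4 * (2 * ((t + 1) * (t + 1) * (t + 2) * ((3 + q) * (3 + q))))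
    ≡⟨ 4[2xy]≡2x[4y] ((t + 1) * (t + 1) * (t + 2)) ((3 + q) * (3 + q)) ⟩
  2 * ((t + 1) * (t + 1) * (t + 2)) * (4 * ((3 + q) * (3 + q)))
    ≤⟨ *-mono-≤ (*-monoʳ-≤ 2 (*-mono-≤ (*-mono-≤ t+1≤M t+1≤M) t+2≤M)) (4[3+q]²≤9[2+q]² q) ⟩
  2 * (M * M * M) * (9 * (M * M))    ≡⟨ 2m³[9m²]≡18m⁵ M ⟩
  18 * M ^ 5                         <⟨ *-monoˡ-< (M ^ 5) {{m^n≢0 M 5}} (s≤s (m≤m+n 18 9)) ⟩
  28 * M ^ 5                         ≤⟨ *-monoʳ-≤ 28 (^-monoʳ-≤ M (m≤m+n 5 d)) ⟩
  28 * M ^ (5 + d)                   ≡⟨ *-assoc 4 7 (M ^ (5 + d)) ⟩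
  4 * (7 * M ^ (5 + d))              ≤⟨ *-monoʳ-≤ 4 hR ⟩
  4 * R                              ∎)
  where
  open ≤-Reasoning
  M = 2 + q
  t+1≤M : t + 1 ≤ M
  t+1≤M = ≤-trans (+-monoʳ-≤ t (n≤1+n 1)) t+2≤M
  4[2xy]≡2x[4y] : ∀ x y → 4 * (2 * (x * y)) ≡ 2 * x * (4 * y)
  4[2xy]≡2x[4y] = solve-∀
  2m³[9m²]≡18m⁵ : ∀ m → 2 * (m * m * m) * (9 * (m * m)) ≡ 18 * (m * (m * (m * (m * (m * 1)))))
  2m³[9m²]≡18m⁵ = solve-∀

2*3[t+1]²[t+2][t+3]<R : ∀ {t d R} → 1 ≤ t → 7 * 2 ^ (5 + d) ≤ R → 2 ^ 7 * t ^ 4 ≤ 2 ^ (6 + d) →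
                        2 * (3 * ((t + 1) * (t + 1) * (t + 2) * (t + 3))) < R
2*3[t+1]²[t+2][t+3]<R {t} {d} {R} 1≤t hR 2⁷t⁴≤2ᶜ = *-cancelˡ-< 128 _ _ (begin-strict
  128 * (2 * (3 * W))        ≡⟨ 128[2[3w]]≡6w*128 W ⟩
  6 * W * 128                ≤⟨ *-monoˡ-≤ 128 (*-monoʳ-≤ 6 ([t+1]²[t+2][t+3]≤48t⁴ 1≤t)) ⟩
  6 * (48 * t ^ 4) * 128     ≡⟨ 6[48x]*128≡288[128x] (t ^ 4) ⟩
  288 * (2 ^ 7 * t ^ 4)      ≤⟨ *-monoʳ-≤ 288 2⁷t⁴≤2ᶜ ⟩
  288 * 2 ^ (6 + d)          ≡⟨ 288[2p]≡576p (2 ^ (5 + d)) ⟩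
  576 * 2 ^ (5 + d)          <⟨ *-monoˡ-< (2 ^ (5 + d)) {{m^n≢0 2 (5 + d)}} (s≤s (m≤m+n 576 319)) ⟩
  896 * 2 ^ (5 + d)          ≡⟨ *-assoc 128 7 (2 ^ (5 + d)) ⟩
  128 * (7 * 2 ^ (5 + d))    ≤⟨ *-monoʳ-≤ 128 hR ⟩
  128 * R                    ∎)
  where
  open ≤-Reasoning
  W = (t + 1) * (t + 1) * (t + 2) * (t + 3)
  128[2[3w]]≡6w*128 : ∀ w → 128 * (2 * (3 * w)) ≡ 6 * w * 128
  128[2[3w]]≡6w*128 = solve-∀
  6[48x]*128≡288[128x] : ∀ x → 6 * (48 * x) * 128 ≡ 288 * (128 * x)
  6[48x]*128≡288[128x] = solve-∀
  288[2p]≡576p : ∀ p → 288 * (2 * p) ≡ 576 * p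
  288[2p]≡576p = solve-∀

r*y<2[r∸e]² : ∀ {r e y} → 2 * e ≤ r → 2 * y < r → r * y < 2 * ((r ∸ e) * (r ∸ e))
r*y<2[r∸e]² {r} {e} {y} 2e≤r 2y<r = *-cancelˡ-< 2 _ _ (begin-strict
  2 * (r * y)           ≡⟨ x∙yz≈y∙xz 2 r y ⟩
  r * (2 * y)           <⟨ *-monoʳ-< r 2y<r ⟩
  r * r                 ≤⟨ *-mono-≤ r≤2x r≤2x ⟩
  (2 * x) * (2 * x)     ≡⟨ 2x*2x≡2[2[x*x]] x ⟩
  2 * (2 * (x * x))     ∎)
  where
  open ≤-Reasoning
  x = r ∸ e
  instance
    r≢0 : NonZero r
    r≢0 = >-nonZero (<-≤-trans (s≤s z≤n) 2y<r)
  r≤2x : r ≤ 2 * x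
  r≤2x = +-cancelʳ-≤ (2 * e) r (2 * x) (begin
    r + 2 * e       ≤⟨ +-monoʳ-≤ r 2e≤r ⟩
    r + r           ≡⟨ cong (λ n → r + n) (+-identityʳ r) ⟨
    2 * r           ≡⟨ cong (2 *_) (m∸n+n≡m (m+n≤o⇒m≤o e 2e≤r)) ⟨
    2 * (x + e)     ≡⟨ *-distribˡ-+ 2 x e ⟩
    2 * x + 2 * e   ∎)
  2x*2x≡2[2[x*x]] : ∀ x → (2 * x) * (2 * x) ≡ 2 * (2 * (x * x))
  2x*2x≡2[2[x*x]] = solve-∀

r*a*b<m[r∸e]² : ∀ {r e y a b m} .{{_ : NonZero m}} → 2 * e ≤ r → 2 * y < r → 2 * (a * b) ≡ m * y →
                r * a * b < m * ((r ∸ e) * (r ∸ e))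
r*a*b<m[r∸e]² {r} {e} {y} {a} {b} {m} 2e≤r 2y<r 2ab≡my = *-cancelˡ-< 2 _ _ (begin-strict
  2 * (r * a * b)                ≡⟨ cong (2 *_) (*-assoc r a b) ⟩
  2 * (r * (a * b))              ≡⟨ x∙yz≈y∙xz 2 r (a * b) ⟩
  r * (2 * (a * b))              ≡⟨ cong (r *_) 2ab≡my ⟩
  r * (m * y)                    ≡⟨ x∙yz≈y∙xz r m y ⟩
  m * (r * y)                    <⟨ *-monoʳ-< m (r*y<2[r∸e]² {r} {e} {y} 2e≤r 2y<r) ⟩
  m * (2 * ((r ∸ e) * (r ∸ e)))  ≡⟨ x∙yz≈y∙xz m 2 _ ⟩
  2 * (m * ((r ∸ e) * (r ∸ e)))  ∎)
  where open ≤-Reasoning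

-- The embedding of ℕ into ℚ

ι : ℕ → ℚ
ι n = + n / 1

toℚᵘ-/ : ∀ i d .{{_ : NonZero d}} → toℚᵘ (i / d) ℚᵘ.≃ (i ℚᵘ./ d)
toℚᵘ-/ i (suc d) = ℚ.toℚᵘ-fromℚᵘ (ℚᵘ.mkℚᵘ i d)

/-* : ∀ i j d e .{{_ : NonZero d}} .{{_ : NonZero e}} →
      (i / d) ℚ.* (j / e) ≡ ((i ℤ.* j) / (d * e)) {{m*n≢0 d e}}
/-* i j d@(suc _) e@(suc _) = ℚ.toℚᵘ-injective (begin
  toℚᵘ ((i / d) ℚ.* (j / e))       ≈⟨ ℚ.toℚᵘ-homo-* (i / d) (j / e) ⟩
  toℚᵘ (i / d) ℚᵘ.* toℚᵘ (j / e)   ≈⟨ ℚᵘ.*-cong (toℚᵘ-/ i d) (toℚᵘ-/ j e) ⟩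
  (i ℚᵘ./ d) ℚᵘ.* (j ℚᵘ./ e)       ≈⟨ toℚᵘ-/ (i ℤ.* j) (d * e) ⟨
  toℚᵘ ((i ℤ.* j) / (d * e))       ∎)
  where open ℚᵘ.≃-Reasoning

*-cancelˡ-/ : ∀ p i d .{{_ : NonZero d}} .{{_ : NonZero (p * d)}} → (+ p ℤ.* i) / (p * d) ≡ i / d
*-cancelˡ-/ p i d = ℚ.toℚᵘ-injective (begin
  toℚᵘ ((+ p ℤ.* i) / (p * d))   ≈⟨ toℚᵘ-/ (+ p ℤ.* i) (p * d) ⟩
  (+ p ℤ.* i) ℚᵘ./ (p * d)       ≈⟨ ℚᵘ.*-cancelˡ-/ p ⟩
  i ℚᵘ./ d                       ≈⟨ toℚᵘ-/ i d ⟨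
  toℚᵘ (i / d)                   ∎)
  where open ℚᵘ.≃-Reasoning

ι-*-/ : ∀ m i d .{{_ : NonZero d}} → ι m ℚ.* (i / d) ≡ (+ m ℤ.* i) / d
ι-*-/ m i d = trans (/-* (+ m) i 1 d) (ℚ./-cong {+ m ℤ.* i} {1 * d} {{m*n≢0 1 d}} refl (*-identityˡ d))

ι-* : ∀ a b → ι (a * b) ≡ ι a ℚ.* ι b
ι-* a b = sym (trans (ι-*-/ a (+ b) 1) (cong (_/ 1) (sym (ℤ.pos-* a b))))

ι-+ : ∀ a b → ι (a + b) ≡ ι a ℚ.+ ι b
ι-+ a b = ℚ.toℚᵘ-injective (begin
  toℚᵘ (ι (a + b))                 ≈⟨ toℚᵘ-/ (+ (a + b)) 1 ⟩
  + (a + b) ℚᵘ./ 1                 ≈⟨ ℚᵘ.*≡* (cong (ℤ._* + 1) numerators) ⟩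
  (+ a ℚᵘ./ 1) ℚᵘ.+ (+ b ℚᵘ./ 1)   ≈⟨ ℚᵘ.+-cong (toℚᵘ-/ (+ a) 1) (toℚᵘ-/ (+ b) 1) ⟨
  toℚᵘ (ι a) ℚᵘ.+ toℚᵘ (ι b)       ≈⟨ ℚ.toℚᵘ-homo-+ (ι a) (ι b) ⟨
  toℚᵘ (ι a ℚ.+ ι b)               ∎)
  where
  open ℚᵘ.≃-Reasoning
  numerators : + (a + b) ≡ + a ℤ.* + 1 ℤ.+ + b ℤ.* + 1
  numerators = trans (ℤ.pos-+ a b) (sym (cong₂ ℤ._+_ (ℤ.*-identityʳ (+ a)) (ℤ.*-identityʳ (+ b))))

ι-∸ : ∀ {r e} → e ≤ r → ι (r ∸ e) ≡ ι r ℚ.- ι e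
ι-∸ {r} {e} e≤r = begin
  ι (r ∸ e)                     ≡⟨ solve 2 (λ x y → x := (y :+ x) :- y) refl (ι (r ∸ e)) (ι e) ⟩
  (ι e ℚ.+ ι (r ∸ e)) ℚ.- ι e   ≡⟨ cong (ℚ._- ι e) (ι-+ e (r ∸ e)) ⟨
  ι (e + (r ∸ e)) ℚ.- ι e       ≡⟨ cong (λ n → ι n ℚ.- ι e) (m+[n∸m]≡n e≤r) ⟩
  ι r ℚ.- ι e                   ∎
  where
  open ≡-Reasoning
  open +-*-Solver

ι-< : ∀ {a b} → a < b → ι a ℚ.< ι b
ι-< {a} {b} a<b = ℚ.toℚᵘ-cancel-<
  (ℚᵘ.<-respˡ-≃ (ℚᵘ.≃-sym (toℚᵘ-/ (+ a) 1)) (ℚᵘ.<-respʳ-≃ (ℚᵘ.≃-sym (toℚᵘ-/ (+ b) 1))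
    (ℚᵘ.*<* (subst₂ ℤ._<_ (sym (ℤ.*-identityʳ (+ a))) (sym (ℤ.*-identityʳ (+ b))) (ℤ.+<+ a<b)))))

ι-*-cancel : ∀ m r q d .{{_ : NonZero d}} .{{_ : NonZero (m * d)}} →
             ι m ℚ.* (+ (r * q) / (m * d)) ≡ ι r ℚ.* (+ q / d)
ι-*-cancel m r q d = begin
  ι m ℚ.* (+ (r * q) / (m * d))   ≡⟨ ι-*-/ m (+ (r * q)) (m * d) ⟩
  (+ m ℤ.* + (r * q)) / (m * d)   ≡⟨ *-cancelˡ-/ m (+ (r * q)) d ⟩
  + (r * q) / d                   ≡⟨ cong (_/ d) (ℤ.pos-* r q) ⟩
  (+ r ℤ.* + q) / d               ≡⟨ ι-*-/ r (+ q) d ⟨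
  ι r ℚ.* (+ q / d)               ∎
  where open ≡-Reasoning

-- With m v = r u, the two sides of the conclusion are u²/m times the two sides of the hypothesis.
rescale-< : ∀ {v u a b m e r : ℚ} .{{_ : Positive u}} .{{_ : Positive m}} → m ℚ.* v ≡ r ℚ.* u →
            r ℚ.* a ℚ.* b ℚ.< m ℚ.* ((r ℚ.- e) ℚ.* (r ℚ.- e)) →
            (v ℚ.* a) ℚ.* (u ℚ.* b) ℚ.< (m ℚ.* v ℚ.- e ℚ.* u) ℚ.* (m ℚ.* v ℚ.- e ℚ.* u)
rescale-< {v} {u} {a} {b} {m} {e} {r} mv≡ru h =
  ℚ.*-cancelˡ-<-nonNeg m {{ℚ.pos⇒nonNeg m}}
    (subst₂ ℚ._<_ (sym left) (sym right) (ℚ.*-monoʳ-<-pos (u ℚ.* u) {{ℚ.pos*pos⇒pos u u}} h))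
  where
  open ≡-Reasoning
  open +-*-Solver
  left : m ℚ.* ((v ℚ.* a) ℚ.* (u ℚ.* b)) ≡ (u ℚ.* u) ℚ.* (r ℚ.* a ℚ.* b)
  left = begin
    m ℚ.* ((v ℚ.* a) ℚ.* (u ℚ.* b))
      ≡⟨ solve 5 (λ m v a u b → m :* ((v :* a) :* (u :* b)) := (m :* v) :* (a :* (u :* b))) refl m v a u b ⟩
    (m ℚ.* v) ℚ.* (a ℚ.* (u ℚ.* b))  ≡⟨ cong (ℚ._* (a ℚ.* (u ℚ.* b))) mv≡ru ⟩
    (r ℚ.* u) ℚ.* (a ℚ.* (u ℚ.* b))
      ≡⟨ solve 4 (λ r u a b → (r :* u) :* (a :* (u :* b)) := (u :* u) :* (r :* a :* b)) refl r u a b ⟩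
    (u ℚ.* u) ℚ.* (r ℚ.* a ℚ.* b)    ∎
  right : m ℚ.* ((m ℚ.* v ℚ.- e ℚ.* u) ℚ.* (m ℚ.* v ℚ.- e ℚ.* u))
        ≡ (u ℚ.* u) ℚ.* (m ℚ.* ((r ℚ.- e) ℚ.* (r ℚ.- e)))
  right = begin
    m ℚ.* ((m ℚ.* v ℚ.- e ℚ.* u) ℚ.* (m ℚ.* v ℚ.- e ℚ.* u))
      ≡⟨ cong (λ x → m ℚ.* ((x ℚ.- e ℚ.* u) ℚ.* (x ℚ.- e ℚ.* u))) mv≡ru ⟩
    m ℚ.* ((r ℚ.* u ℚ.- e ℚ.* u) ℚ.* (r ℚ.* u ℚ.- e ℚ.* u))
      ≡⟨ solve 4 (λ m r u e → m :* ((r :* u :- e :* u) :* (r :* u :- e :* u))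
                            := (u :* u) :* (m :* ((r :- e) :* (r :- e)))) refl m r u e ⟩
    (u ℚ.* u) ℚ.* (m ℚ.* ((r ℚ.- e) ℚ.* (r ℚ.- e))) ∎

rescale-<-ι : ∀ {v u : ℚ} {a b m e r : ℕ} .{{_ : Positive u}} .{{_ : NonZero m}} →
              ι m ℚ.* v ≡ ι r ℚ.* u → e ≤ r → r * a * b < m * ((r ∸ e) * (r ∸ e)) →
              (v ℚ.* ι a) ℚ.* (u ℚ.* ι b) ℚ.< (ι m ℚ.* v ℚ.- ι e ℚ.* u) ℚ.* (ι m ℚ.* v ℚ.- ι e ℚ.* u)
rescale-<-ι {v} {u} {a} {b} {m} {e} {r} mv≡ru e≤r h =
  rescale-< {v} {u} {ι a} {ι b} {ι m} {ι e} {ι r} mv≡ru (subst₂ ℚ._<_ ι[rab] ι[mx²] (ι-< h))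
  where
  instance
    ιm>0 : Positive (ι m)
    ιm>0 = ℚ.normalize-pos m 1
  ι[rab] : ι (r * a * b) ≡ ι r ℚ.* ι a ℚ.* ι b
  ι[rab] = trans (ι-* (r * a) b) (cong (ℚ._* ι b) (ι-* r a))
  ι[mx²] : ι (m * ((r ∸ e) * (r ∸ e))) ≡ ι m ℚ.* ((ι r ℚ.- ι e) ℚ.* (ι r ℚ.- ι e))
  ι[mx²] = trans (ι-* m _) (cong (ι m ℚ.*_) (trans (ι-* (r ∸ e) (r ∸ e)) (cong₂ ℚ._*_ (ι-∸ e≤r) (ι-∸ e≤r))))

-- The products θ

∏-split : ∀ a b (f : ℕ → ℕ) → a < b → ∏[ a ≤i< b ] f ≡ f a * ∏[ suc a ≤i< b ] f
∏-split a b f a<b rewrite +-∸-assoc 1 a<b = cong₂ _*_ (cong f (+-identityʳ a)) (cong product (begin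
  map (λ j → f (a + j)) (applyUpTo suc (b ∸ suc a))  ≡⟨ map-applyUpTo suc _ _ ⟩
  applyUpTo (λ j → f (a + suc j)) (b ∸ suc a)        ≡⟨ map-upTo _ _ ⟨
  map (λ j → f (a + suc j)) (upTo (b ∸ suc a))       ≡⟨ map-cong (λ j → cong f (+-suc a j)) _ ⟩
  map (λ j → f (suc a + j)) (upTo (b ∸ suc a))       ∎))
  where open ≡-Reasoning

∏-nonZero : ∀ a b (f : ℕ → ℕ) → (∀ {j} → j < b ∸ a → NonZero (f (a + j))) → NonZero (∏[ a ≤i< b ] f)
∏-nonZero a b f nz = product≢0 (subst (All NonZero) (sym (map-upTo _ (b ∸ a))) (applyUpTo⁺₁ _ (b ∸ a) nz))

θ-positive : ∀ c k z → Positive (θ c k z)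
θ-positive c k z = ℚ.normalize-pos _ ((k ∸ z) !) {{(k ∸ z) !≢0}} {{∏-nonZero z k (λ i → ((k ∸ i) * c) C c) factor≢0}}
  where
  factor≢0 : ∀ {j} → j < k ∸ z → NonZero (((k ∸ (z + j)) * c) C c)
  factor≢0 {j} j<k∸z = >-nonZero (nCk-pos (m≤n*m c (k ∸ (z + j)) {{>-nonZero k∸[z+j]>0}}))
    where
    k∸[z+j]>0 : 0 < k ∸ (z + j)
    k∸[z+j]>0 = subst (0 <_) (∸-+-assoc k z j) (m<n⇒0<n∸m j<k∸z)

θ-step : ∀ c k z → z < k → ι (k ∸ z) ℚ.* θ c k z ≡ ι (((k ∸ z) * c) C c) ℚ.* θ c k (suc z)
θ-step c k z z<k = begin
  ι (k ∸ z) ℚ.* θ c k z                          ≡⟨ cong (λ l → ι l ℚ.* θ c k z) k∸z≡1+n ⟩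
  ι (suc n) ℚ.* θ c k z                          ≡⟨ cong (ι (suc n) ℚ.*_) θ-unfold ⟩
  ι (suc n) ℚ.* (+ (h z * P) / (suc n * n !))    ≡⟨ ι-*-cancel (suc n) (h z) P (n !) {{n !≢0}} ⟩
  ι (h z) ℚ.* θ c k (suc z)                      ∎
  where
  open ≡-Reasoning
  h : ℕ → ℕ
  h i = ((k ∸ i) * c) C c
  n = k ∸ suc z
  P = ∏[ suc z ≤i< k ] h
  k∸z≡1+n : k ∸ z ≡ suc n
  k∸z≡1+n = +-∸-assoc 1 z<k
  instance
    [1+n]!≢0 : NonZero (suc n * n !)
    [1+n]!≢0 = suc n !≢0
  θ-unfold : θ c k z ≡ + (h z * P) / (suc n * n !)
  θ-unfold = ℚ./-cong {{(k ∸ z) !≢0}} (cong +_ (∏-split z k h z<k)) (cong _! k∸z≡1+n)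

θ-last-step : ∀ c z → θ c (suc z) z ≡ θ c (suc z) (suc z)
θ-last-step c z = begin
  θ c (suc z) z                                       ≡⟨ ℚ.*-identityˡ _ ⟨
  ι 1 ℚ.* θ c (suc z) z                               ≡⟨ cong (λ n → ι n ℚ.* θ c (suc z) z) (m+n∸n≡m 1 z) ⟨
  ι (suc z ∸ z) ℚ.* θ c (suc z) z                     ≡⟨ θ-step c (suc z) z ≤-refl ⟩
  ι (((suc z ∸ z) * c) C c) ℚ.* θ c (suc z) (suc z)   ≡⟨ cong (λ n → ι (n C c) ℚ.* θ c (suc z) (suc z)) [1+z∸z]*c≡c ⟩
  ι (c C c) ℚ.* θ c (suc z) (suc z)                   ≡⟨ cong (λ n → ι n ℚ.* θ c (suc z) (suc z)) (nCn≡1 c) ⟩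
  ι 1 ℚ.* θ c (suc z) (suc z)                         ≡⟨ ℚ.*-identityˡ _ ⟩
  θ c (suc z) (suc z)                                 ∎
  where
  open ≡-Reasoning
  [1+z∸z]*c≡c : (suc z ∸ z) * c ≡ c
  [1+z∸z]*c≡c = trans (cong (_* c) (m+n∸n≡m 1 z)) (*-identityˡ c)

-- The setting of the lemma: c = 6 + d, k = t + 3 + o and m = k − t − 1 = 2 + o

module Setting (d t o : ℕ) where

  c = 6 + d
  k = t + (3 + o)
  m = 2 + o
  R = (m * c) C c
  e = m C 2

  -- g c k t z ≡ θ c k z ℚ.* ι (weight z) holds by definition.
  weight : ℕ → ℕ
  weight z = (z C t) * ∏[1≤j≤ z ∸ t ] (λ j → k ∸ (t + j ∸ 1))

  k∸[t+j]≡[3+o]∸j : ∀ j → k ∸ (t + j) ≡ (3 + o) ∸ j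
  k∸[t+j]≡[3+o]∸j = [m+n]∸[m+o]≡n∸o t (3 + o)

  θ-ratio : ι m ℚ.* θ c k (t + 1) ≡ ι R ℚ.* θ c k (t + 2)
  θ-ratio = subst₂ (λ n z → ι n ℚ.* θ c k (t + 1) ≡ ι ((n * c) C c) ℚ.* θ c k z)
    (k∸[t+j]≡[3+o]∸j 1) (sym (+-suc t 1))
    (θ-step c k (t + 1) (+-monoʳ-< t (s≤s (s≤s z≤n))))

  F = ι m ℚ.* θ c k (t + 1) ℚ.- ι e ℚ.* θ c k (t + 2)

  f₀≡F : f₀ c k t ≡ F
  f₀≡F = cong (λ n → ι n ℚ.* θ c k (t + 1) ℚ.- ι (n C 2) ℚ.* θ c k (t + 2))
    (trans (∸-+-assoc k t 1) (k∸[t+j]≡[3+o]∸j 1))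

  weight[t+n] : ∀ n → weight (t + n) ≡ ((t + n) C t) * product (map ((3 + o) ∸_) (upTo n))
  weight[t+n] n = cong (((t + n) C t) *_) (begin
    ∏[1≤j≤ t + n ∸ t ] (λ j → k ∸ (t + j ∸ 1))  ≡⟨ cong (λ l → ∏[1≤j≤ l ] (λ j → k ∸ (t + j ∸ 1))) (m+n∸m≡n t n) ⟩
    ∏[1≤j≤ n ] (λ j → k ∸ (t + j ∸ 1))          ≡⟨ cong product (map-cong factor (upTo n)) ⟩
    product (map ((3 + o) ∸_) (upTo n))         ∎)
    where
    open ≡-Reasoning
    factor : ∀ j → k ∸ (t + suc j ∸ 1) ≡ (3 + o) ∸ j
    factor j = trans (cong (k ∸_) (+-∸-assoc t (s≤s z≤n))) (k∸[t+j]≡[3+o]∸j j)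

  2*weight[t+1]*weight[t+2] : 2 * (weight (t + 1) * weight (t + 2)) ≡ m * ((t + 1) * (t + 1) * (t + 2) * ((3 + o) * (3 + o)))
  2*weight[t+1]*weight[t+2] = begin
    2 * (weight (t + 1) * weight (t + 2))
      ≡⟨ cong₂ (λ a b → 2 * (a * b)) (weight[t+n] 1) (weight[t+n] 2) ⟩
    2 * (((t + 1) C t) * ((3 + o) * 1) * (((t + 2) C t) * ((3 + o) * ((2 + o) * 1))))
      ≡⟨ cong (λ a → 2 * (a * ((3 + o) * 1) * (((t + 2) C t) * ((3 + o) * ((2 + o) * 1))))) ([n+1]Cn≡n+1 t) ⟩
    2 * ((t + 1) * ((3 + o) * 1) * (((t + 2) C t) * ((3 + o) * ((2 + o) * 1))))
      ≡⟨ isolate-2x (t + 1) (3 + o) (2 + o) ((t + 2) C t) ⟩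
    (t + 1) * (3 + o) * (3 + o) * (2 + o) * (2 * ((t + 2) C t))
      ≡⟨ cong ((t + 1) * (3 + o) * (3 + o) * (2 + o) *_) (2*[n+2]Cn≡[n+2][n+1] t) ⟩
    (t + 1) * (3 + o) * (3 + o) * (2 + o) * ((t + 2) * (t + 1))
      ≡⟨ regroup (t + 1) (t + 2) (3 + o) (2 + o) ⟩
    m * ((t + 1) * (t + 1) * (t + 2) * ((3 + o) * (3 + o))) ∎
    where
    open ≡-Reasoning
    isolate-2x : ∀ a b c x → 2 * (a * (b * 1) * (x * (b * (c * 1)))) ≡ a * b * b * c * (2 * x)
    isolate-2x = solve-∀
    regroup : ∀ a a′ b c → a * b * b * c * (a′ * a) ≡ c * (a * a * a′ * (b * b))
    regroup = solve-∀

  R-lower-bound : 7 * m ^ (5 + d) ≤ R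
  R-lower-bound = 7*[2+q]^[5+d]≤[2+q][6+d]C[6+d] o d

  2e≤R : 2 * e ≤ R
  2e≤R = 2*[2+q]C2≤R {o} {d} R-lower-bound

  e≤R : e ≤ R
  e≤R = m+n≤o⇒m≤o e 2e≤R

2t+3≤t+[3+o]⇒t+2≤2+o : ∀ {t o} → 2 * t + 3 ≤ t + (3 + o) → t + 2 ≤ 2 + o
2t+3≤t+[3+o]⇒t+2≤2+o {t} {o} h = subst (t + 2 ≤_) (+-comm o 2) (+-monoˡ-≤ 2 t≤o)
  where
  2t+3≡t+3+t : ∀ t → 2 * t + 3 ≡ t + 3 + t
  2t+3≡t+3+t = solve-∀
  t≤o : t ≤ o
  t≤o = +-cancelˡ-≤ (t + 3) t o (subst₂ _≤_ (2t+3≡t+3+t t) (sym (+-assoc t 3 o)) h)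

-- c and k are passed through equations matched against refl: instantiating them by a with-abstraction
-- over these goals makes the type checker unfold g and f₀.
lemma6p2-i : ∀ {c k} d t o → 6 + d ≡ c → t + (3 + o) ≡ k → 1 ≤ t → (2 ^ 7 * t ^ 4 ≤ 2 ^ c ⊎ 2 * t + 3 ≤ k) →
  g c k t (t + 1) ℚ.* g c k t (t + 2) ℚ.< f₀ c k t ℚ.* f₀ c k t
lemma6p2-i d t o refl refl 1≤t h = subst (λ f → g c k t (t + 1) ℚ.* g c k t (t + 2) ℚ.< f ℚ.* f) (sym f₀≡F) g*g<F*F
  where
  open Setting d t o
  Y = (t + 1) * (t + 1) * (t + 2) * ((3 + o) * (3 + o))
  integral : R * weight (t + 1) * weight (t + 2) < m * ((R ∸ e) * (R ∸ e))
  integral = r*a*b<m[r∸e]² {R} {e} {Y} {weight (t + 1)} {weight (t + 2)} {m} 2e≤R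
    (2*[t+1]²[t+2][3+q]²<R {t} {o} {d} 1≤t R-lower-bound (map₂ 2t+3≤t+[3+o]⇒t+2≤2+o h))
    2*weight[t+1]*weight[t+2]
  g*g<F*F : g c k t (t + 1) ℚ.* g c k t (t + 2) ℚ.< F ℚ.* F
  g*g<F*F = rescale-<-ι {θ c k (t + 1)} {θ c k (t + 2)} {weight (t + 1)} {weight (t + 2)} {m} {e} {R} {{θ-positive c k (t + 2)}}
    θ-ratio e≤R integral

lemma6p2-ii : ∀ {c} d t → 6 + d ≡ c → 1 ≤ t → 2 ^ 7 * t ^ 4 ≤ 2 ^ c →
  g c (t + 3) t (t + 1) ℚ.* g c (t + 3) t (t + 3) ℚ.< f₀ c (t + 3) t ℚ.* f₀ c (t + 3) t
lemma6p2-ii d t refl 1≤t h = subst (λ f → g c k t (t + 1) ℚ.* g c k t (t + 3) ℚ.< f ℚ.* f) (sym f₀≡F) g*g<F*F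
  where
  open Setting d t 0
  Y = 3 * ((t + 1) * (t + 1) * (t + 2) * (t + 3))
  2*weight[t+1]*weight[t+3] : 2 * (weight (t + 1) * weight (t + 3)) ≡ 2 * Y
  2*weight[t+1]*weight[t+3] = begin
    2 * (weight (t + 1) * weight (t + 3))
      ≡⟨ cong₂ (λ a b → 2 * (a * b)) (weight[t+n] 1) (weight[t+n] 3) ⟩
    2 * (((t + 1) C t) * (3 * 1) * (((t + 3) C t) * (3 * (2 * (1 * 1)))))
      ≡⟨ cong (λ a → 2 * (a * (3 * 1) * (((t + 3) C t) * 6))) ([n+1]Cn≡n+1 t) ⟩
    2 * ((t + 1) * (3 * 1) * (((t + 3) C t) * 6))
      ≡⟨ isolate-6x (t + 1) ((t + 3) C t) ⟩
    2 * (3 * ((t + 1) * (6 * ((t + 3) C t))))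
      ≡⟨ cong (λ x → 2 * (3 * ((t + 1) * x))) (6*[n+3]Cn≡[n+3][n+2][n+1] t) ⟩
    2 * (3 * ((t + 1) * ((t + 3) * ((t + 2) * (t + 1)))))
      ≡⟨ regroup (t + 1) (t + 2) (t + 3) ⟩
    2 * Y ∎
    where
    open ≡-Reasoning
    isolate-6x : ∀ a x → 2 * (a * (3 * 1) * (x * 6)) ≡ 2 * (3 * (a * (6 * x)))
    isolate-6x = solve-∀
    regroup : ∀ a b c → 2 * (3 * (a * (c * (b * a)))) ≡ 2 * (3 * (a * a * b * c))
    regroup = solve-∀
  θ[t+2]≡θ[t+3] : θ c k (t + 2) ≡ θ c k (t + 3)
  θ[t+2]≡θ[t+3] = subst (λ k → θ c k (t + 2) ≡ θ c k k) (sym (+-suc t 2)) (θ-last-step c (t + 2))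
  integral : R * weight (t + 1) * weight (t + 3) < 2 * ((R ∸ e) * (R ∸ e))
  integral = r*a*b<m[r∸e]² {R} {e} {Y} {weight (t + 1)} {weight (t + 3)} {m} 2e≤R
    (2*3[t+1]²[t+2][t+3]<R {t} {d} 1≤t R-lower-bound h) 2*weight[t+1]*weight[t+3]
  g*g<F*F : g c k t (t + 1) ℚ.* g c k t (t + 3) ℚ.< F ℚ.* F
  g*g<F*F = subst (λ θ₃ → (θ c k (t + 1) ℚ.* ι (weight (t + 1))) ℚ.* (θ₃ ℚ.* ι (weight (t + 3))) ℚ.< F ℚ.* F)
    θ[t+2]≡θ[t+3]
    (rescale-<-ι {θ c k (t + 1)} {θ c k (t + 2)} {weight (t + 1)} {weight (t + 3)} {m} {e} {R} {{θ-positive c k (t + 2)}}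
      θ-ratio e≤R integral)

lemma6p2 : (c k t : ℕ) → 1 ≤ c → 1 ≤ k → 1 ≤ t → 6 ≤ c → t + 3 ≤ k →
    (((2 ^ 7) * (t ^ 4) ≤ 2 ^ c ⊎ 2 * t + 3 ≤ k) →
      g c k t (t + 1) ℚ.* g c k t (t + 2) ℚ.< f₀ c k t ℚ.* f₀ c k t)
    × ((2 ^ 7) * (t ^ 4) ≤ 2 ^ c →
      g c (t + 3) t (t + 1) ℚ.* g c (t + 3) t (t + 3) ℚ.< f₀ c (t + 3) t ℚ.* f₀ c (t + 3) t)
lemma6p2 c k t _ _ 1≤t 6≤c t+3≤k =
  let (d , 6+d≡c) = m≤n⇒∃[o]m+o≡n 6≤c
      (o , t+3+o≡k) = m≤n⇒∃[o]m+o≡n t+3≤k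
  in lemma6p2-i d t o 6+d≡c (trans (sym (+-assoc t 3 o)) t+3+o≡k) 1≤t , lemma6p2-ii d t 6+d≡c 1≤t
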